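{- Let $p=\sum_{i=1}^n a_ix_i+a_0$ be a strongly admissible pattern and let $m$ be a $p$-admissible multiplicity. (1) If a numerical semigroup $\Lambda$ of multiplicity $m$ with $\Lambda\neq\{0\}\cup\{m,m+1,\dots\}$ admits $p$, then so does $\Lambda\cup\{\mathrm F(\Lambda)\}$. (2) The intersection of two numerical semigroups of multiplicity $m$ admitting $p$ also has multiplicity $m$ and admits $p$.
   Context: A numerical semigroup is a subset $\Lambda\subseteq\mathbb N_0$ containing $0$, closed under addition, with finite complement; its multiplicity is its smallest nonzero element and $\mathrm F(\Lambda)$ is the largest integer not in $\Lambda$. A (nonhomogeneous) pattern is $p(x_1,\dots,x_n)=\sum_{i=1}^n a_ix_i+a_0$ with $a_1,\dots,a_n$ nonzero integers and $a_0$ a nonzero integer; $\Lambda$ admits $p$ if $p(s_1,\dots,s_n)\in\Lambda$ for all nonzero $s_1\geq\cdots\geq s_n$ in $\Lambda$. Put $\sigma_j=\sum_{i=1}^j a_i$. $p$ is admissible if $\sigma_j\geq0$ for all $j\le n$ and either $a_0\geq 0$ or $\sigma_n>1$. A positive integer $m$ is a $p$-admissible multiplicity if $m\geq -a_0/(\sigma_n-1)$ when $\sigma_n>1$, no condition when $\sigma_n=1$, and $m\le a_0$ when $\sigma_n=0$. For admissible $p$ (so $a_1\ge1$) define $p'=p-x_1$ if $a_1>1$ and $p'=p(0,x_1,\dots,x_{n-1})$ if $a_1=1$; let $\sigma'_j$ be the partial sums of the coefficients of the variables of $p'$. $p$ is strongly admissible if it is admissible and all $\sigma'_j\geq 0$.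 -}

module Defs where

open import Data.Nat as ℕ using (ℕ; zero; suc)
open import Data.Integer as ℤ using (ℤ; +_)
open import Data.Bool using (Bool; true; false; _∨_; _∧_)
open import Data.List using (List; []; _∷_; length; take; foldr)
open import Data.Vec using (Vec; []; _∷_; lookup)
open import Data.Fin using (Fin; toℕ)
open import Data.Product using (Σ; _×_; _,_)
open import Data.Sum using (_⊎_)
open import Relation.Binary.PropositionalEquality using (_≡_)
open import Relation.Nullary using (¬_; yes; no)
open import Data.Unit using (⊤)

Subset : Set
Subset = ℕ → Bool

_∈_ : ℕ → Subset → Set
n ∈ Λ = Λ n ≡ true

_∉_ : ℕ → Subset → Set
n ∉ Λ = ¬ (n ∈ Λ)

_∈ℤ_ : ℤ → Subset → Set
z ∈ℤ Λ = Σ ℕ λ k → (z ≡ + k) × (k ∈ Λ)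

insert : Subset → ℕ → Subset
insert Λ f n = Λ n ∨ (n ℕ.≡ᵇ f)

_∩_ : Subset → Subset → Subset
(Λ ∩ Λ') n = Λ n ∧ Λ' n

record IsNumericalSemigroup (Λ : Subset) : Set where
  field
    has-zero   : 0 ∈ Λ
    closed-add : ∀ x y → x ∈ Λ → y ∈ Λ → (x ℕ.+ y) ∈ Λ
    cofinite   : Σ ℕ λ N → ∀ x → N ℕ.≤ x → x ∈ Λ

IsMultiplicity : Subset → ℕ → Set
IsMultiplicity Λ m = (1 ℕ.≤ m) × (m ∈ Λ) × (∀ s → 1 ℕ.≤ s → s ℕ.< m → s ∉ Λ)

-- f is the Frobenius number F(Λ): the largest integer not in Λ
-- (stated for a natural number f; used only when Λ ≠ ℕ₀)
IsFrobenius : Subset → ℕ → Set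
IsFrobenius Λ f = (f ∉ Λ) × (∀ x → f ℕ.< x → x ∈ Λ)

ordinary : ℕ → Subset
ordinary m zero    = true
ordinary m (suc n) = m ℕ.≤ᵇ suc n

_≐_ : Subset → Subset → Set
Λ ≐ Λ' = ∀ n → Λ n ≡ Λ' n

-- Patterns p(x₁,…,xₙ) = a₁x₁ + … + aₙxₙ + a₀, with n ≥ 1.
-- Coefficients: a₁ = a1, (a₂,…,aₙ) = rest, constant a0.

record Pattern : Set where
  constructor mkPattern
  field
    a1   : ℤ
    rest : List ℤ
    a0   : ℤ

  coeffs : List ℤ
  coeffs = a1 ∷ rest

  arity : ℕ
  arity = length coeffs

open Pattern public

sumℤ : List ℤ → ℤ
sumℤ = foldr ℤ._+_ (+ 0)

σ : Pattern → ℕ → ℤ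
σ p j = sumℤ (take j (coeffs p))

σn : Pattern → ℤ
σn p = sumℤ (coeffs p)

AllNonzero : List ℤ → Set
AllNonzero []       = ⊤
AllNonzero (a ∷ as) = ¬ (a ≡ + 0) × AllNonzero as

IsPattern : Pattern → Set
IsPattern p = AllNonzero (coeffs p) × ¬ (a0 p ≡ + 0)

PrefixNonneg : List ℤ → Set
PrefixNonneg cs = ∀ j → 1 ℕ.≤ j → j ℕ.≤ length cs → + 0 ℤ.≤ sumℤ (take j cs)

Admissible : Pattern → Set
Admissible p = PrefixNonneg (coeffs p) × ((+ 0 ℤ.≤ a0 p) ⊎ (+ 1 ℤ.< σn p))

-- coefficients of the variables of p':
--   p' = p - x₁ if a₁ > 1,  p' = p(0,x₁,…,x_{n-1}) if a₁ = 1
primeCoeffs : Pattern → List ℤ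
primeCoeffs p with a1 p ℤ.≟ + 1
... | yes _ = rest p
... | no  _ = (a1 p ℤ.- + 1) ∷ rest p

StronglyAdmissible : Pattern → Set
StronglyAdmissible p = Admissible p × PrefixNonneg (primeCoeffs p)

-- p-admissible multiplicity (m positive):
--   σ_n > 1 : m ≥ -a₀/(σ_n - 1), i.e. m·(σ_n - 1) ≥ -a₀ (σ_n - 1 > 0)
--   σ_n = 1 : no condition
--   σ_n = 0 : m ≤ a₀
AdmissibleMultiplicity : Pattern → ℕ → Set
AdmissibleMultiplicity p m =
  (1 ℕ.≤ m)
  × ((+ 1 ℤ.< σn p) → ℤ.- a0 p ℤ.≤ + m ℤ.* (σn p ℤ.- + 1))
  × ((σn p ≡ + 0) → + m ℤ.≤ a0 p)

evalLin : (cs : List ℤ) → Vec ℕ (length cs) → ℤ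
evalLin []       []       = + 0
evalLin (c ∷ cs) (s ∷ ss) = c ℤ.* + s ℤ.+ evalLin cs ss

eval : (p : Pattern) → Vec ℕ (arity p) → ℤ
eval p s = evalLin (coeffs p) s ℤ.+ a0 p

Admits : Subset → Pattern → Set
Admits Λ p =
  (s : Vec ℕ (arity p)) →
  (∀ i → (1 ℕ.≤ lookup s i) × (lookup s i ∈ Λ)) →
  (∀ i j → toℕ i ℕ.≤ toℕ j → lookup s j ℕ.≤ lookup s i) →
  eval p s ∈ℤ Λ

module Submission where

-- Write σ' for the coefficient sum of the derived pattern p', so
-- σ' = σₙ - 1 and p(s) = s₁ + p'-part(s) + a₀.  For s₁ ≥ ⋯ ≥ sₙ ≥ m, Abel
-- summation over the nonnegative partial sums of p' bounds the p'-part from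
-- below by σ'·m, and p-admissibility of m makes σ'·m + a₀ ≥ 0; hence
-- p(s) ≥ s₁ (`pattern-dominates-first`).
--
-- (1) Let f = F(Λ).  Since Λ is not ordinary, m ≤ f, so every nonzero element
-- of Λ ∪ {f} is ≥ m.  If s₁ < f, all sᵢ lie in Λ and Λ admits p.  If s₁ ≥ f,
-- then p(s) ≥ s₁ ≥ f and everything ≥ f lies in Λ ∪ {f}.
-- (2) Multiplicity is preserved by intersection, and p(s) lands in both Λ and
-- Λ' whenever all sᵢ lie in both (no strong admissibility is needed).

open import Defs
open import Data.Nat using (ℕ)
open import Data.Product using (_×_)
open import Relation.Nullary using (¬_)

open import Data.Nat as ℕ using (zero; suc; z≤n; s≤s)
import Data.Nat.Properties as ℕₚ
open import Data.Integer as ℤ using (ℤ; +_; +≤+; _+_; _*_; _-_; -_; _≤_)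
open import Data.Integer.Properties
  using (+-assoc; +-identityʳ; *-identityˡ; *-zeroʳ; +-monoˡ-≤; +-monoʳ-≤; +-mono-≤;
         *-monoˡ-≤-nonNeg; ≤-trans; i≤j⇒0≤j-i; 0≤i⇒+∣i∣≡i; drop‿+≤+; +-injective;
         module ≤-Reasoning)
open import Data.Integer.Tactic.RingSolver using (solve-∀)
open import Data.Bool using (true; false; _∨_)
open import Data.Bool.Properties using (T-≡; ∨-zeroʳ; ⇔→≡)
open import Data.List using (List; []; _∷_; length; take)
import Data.List.Properties as Listₚ
open import Data.Vec using (Vec; []; _∷_; lookup; head)
open import Data.Fin using (toℕ) renaming (zero to fzero; suc to fsuc)
open import Data.Product using (_,_; proj₁; proj₂)
open import Data.Sum using (inj₁; inj₂)
open import Data.Empty using (⊥-elim)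
open import Function using (_∘_)
open import Function.Bundles using (Equivalence; mk⇔)
open import Relation.Nullary using (yes; no)
open import Relation.Binary.PropositionalEquality using (_≡_; _≢_; refl; sym; trans; cong; subst)

Descending : ∀ {n} → Vec ℕ n → Set
Descending s = ∀ i j → toℕ i ℕ.≤ toℕ j → lookup s j ℕ.≤ lookup s i

descending-tail : ∀ {n x} {s : Vec ℕ n} → Descending (x ∷ s) → Descending s
descending-tail d i j i≤j = d (fsuc i) (fsuc j) (s≤s i≤j)

scale-mono : ∀ {c i j} → + 0 ≤ c → i ≤ j → c * i ≤ c * j
scale-mono {c} 0≤c = *-monoˡ-≤-nonNeg c {{ℤ.nonNegative 0≤c}}

prefix-head : ∀ {a cs} → PrefixNonneg (a ∷ cs) → + 0 ≤ a
prefix-head {a} h = subst (+ 0 ≤_) (+-identityʳ a) (h 1 (s≤s z≤n) (s≤s z≤n))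

-- Merging the first two coefficients keeps all partial sums nonnegative:
-- the partial sums of (a + c) ∷ cs are those of a ∷ c ∷ cs from the second on.
prefix-merge : ∀ {a c cs} → PrefixNonneg (a ∷ c ∷ cs) → PrefixNonneg ((a + c) ∷ cs)
prefix-merge {a} {c} {cs} h (suc j) _ (s≤s j≤n) =
  subst (+ 0 ≤_) (sym (+-assoc a c (sumℤ (take j cs))))
    (h (suc (suc j)) (s≤s z≤n) (s≤s (s≤s j≤n)))

prefix-total : ∀ cs → PrefixNonneg cs → + 0 ≤ sumℤ cs
prefix-total [] _ = +≤+ z≤n
prefix-total cs@(_ ∷ _) h =
  subst (λ l → + 0 ≤ sumℤ l) (Listₚ.take-all (length cs) cs ℕₚ.≤-refl)
    (h (length cs) (s≤s z≤n) ℕₚ.≤-refl)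

-- Abel summation, one merge at a time: since a ≥ 0 and s ≥ s', replacing
-- a·s + c·s' by (a + c)·s' lowers the value, and the merged list still has
-- nonnegative partial sums.
merge-bound : (a : ℤ) (cs : List ℤ) (s : ℕ) (ss : Vec ℕ (length cs)) (b : ℕ) →
  PrefixNonneg (a ∷ cs) → Descending (s ∷ ss) → (∀ i → b ℕ.≤ lookup (s ∷ ss) i) →
  sumℤ (a ∷ cs) * + b ≤ evalLin (a ∷ cs) (s ∷ ss)
merge-bound a [] s [] b h _ lo = begin
  (a + + 0) * + b   ≡⟨ cong (_* + b) (+-identityʳ a) ⟩
  a * + b           ≤⟨ scale-mono (prefix-head h) (+≤+ (lo fzero)) ⟩
  a * + s           ≡⟨ sym (+-identityʳ (a * + s)) ⟩
  a * + s + + 0     ∎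
  where open ≤-Reasoning
merge-bound a (c ∷ cs) s (s' ∷ ss) b h d lo = begin
  (a + (c + sumℤ cs)) * + b       ≡⟨ cong (_* + b) (sym (+-assoc a c (sumℤ cs))) ⟩
  (a + c + sumℤ cs) * + b         ≤⟨ merge-bound (a + c) cs s' ss b (prefix-merge h)
                                       (descending-tail d) (lo ∘ fsuc) ⟩
  (a + c) * + s' + E              ≡⟨ split a c (+ s') E ⟩
  a * + s' + (c * + s' + E)       ≤⟨ +-monoˡ-≤ (c * + s' + E)
                                       (scale-mono (prefix-head h) (+≤+ (d fzero (fsuc fzero) z≤n))) ⟩
  a * + s + (c * + s' + E)        ∎
  where
  open ≤-Reasoning
  E = evalLin cs ss
  split : ∀ a c s e → (a + c) * s + e ≡ a * s + (c * s + e)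
  split = solve-∀

abel-bound : (cs : List ℤ) (ss : Vec ℕ (length cs)) (b : ℕ) →
  PrefixNonneg cs → Descending ss → (∀ i → b ℕ.≤ lookup ss i) →
  sumℤ cs * + b ≤ evalLin cs ss
abel-bound [] [] b _ _ _ = +≤+ z≤n
abel-bound (a ∷ cs) (s ∷ ss) = merge-bound a cs s ss

prime-sum : (p : Pattern) → sumℤ (primeCoeffs p) ≡ σn p - + 1
prime-sum (mkPattern a1 rest a0) with a1 ℤ.≟ + 1
... | yes refl = shift (sumℤ rest)
  where
  shift : ∀ r → r ≡ (+ 1 + r) - + 1
  shift = solve-∀
... | no _ = shift a1 (sumℤ rest)
  where
  shift : ∀ a r → (a - + 1) + r ≡ (a + r) - + 1
  shift = solve-∀

-- Σ aᵢsᵢ = s₁ + (the linear part of p' at the remaining variables), and the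
-- latter is bounded by Abel's inequality.
first-variable-bound : (p : Pattern) → PrefixNonneg (primeCoeffs p) →
  (b : ℕ) (s : Vec ℕ (arity p)) → Descending s → (∀ i → b ℕ.≤ lookup s i) →
  + head s + sumℤ (primeCoeffs p) * + b ≤ evalLin (coeffs p) s
first-variable-bound (mkPattern a1 rest a0) h b (s₁ ∷ ss) d lo with a1 ℤ.≟ + 1
... | yes refl = begin
  + s₁ + sumℤ rest * + b         ≤⟨ +-monoʳ-≤ (+ s₁)
                                      (abel-bound rest ss b h (descending-tail d) (lo ∘ fsuc)) ⟩
  + s₁ + evalLin rest ss         ≡⟨ cong (_+ evalLin rest ss) (sym (*-identityˡ (+ s₁))) ⟩
  + 1 * + s₁ + evalLin rest ss   ∎
  where open ≤-Reasoning
... | no _ = begin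
  + s₁ + sumℤ ((a1 - + 1) ∷ rest) * + b        ≤⟨ +-monoʳ-≤ (+ s₁)
                                                    (abel-bound _ (s₁ ∷ ss) b h d lo) ⟩
  + s₁ + ((a1 - + 1) * + s₁ + evalLin rest ss) ≡⟨ peel a1 (+ s₁) (evalLin rest ss) ⟩
  a1 * + s₁ + evalLin rest ss                  ∎
  where
  open ≤-Reasoning
  peel : ∀ a s e → s + ((a - + 1) * s + e) ≡ a * s + e
  peel = solve-∀

constant-absorbed : (p : Pattern) → StronglyAdmissible p →
  (m : ℕ) → AdmissibleMultiplicity p m → + 0 ≤ sumℤ (primeCoeffs p) * + m + a0 p
constant-absorbed p ((_ , inj₁ 0≤a₀) , h') m _ =
  +-mono-≤ (subst (_≤ σ' * + m) (*-zeroʳ σ') (scale-mono (prefix-total _ h') (+≤+ z≤n))) 0≤a₀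
  where σ' = sumℤ (primeCoeffs p)
constant-absorbed p ((_ , inj₂ 1<σₙ) , _) m (_ , bound , _) =
  subst (+ 0 ≤_) eq (i≤j⇒0≤j-i (bound 1<σₙ))
  where
  rearrange : ∀ m t a → m * t - - a ≡ t * m + a
  rearrange = solve-∀
  eq : + m * (σn p - + 1) - - a0 p ≡ sumℤ (primeCoeffs p) * + m + a0 p
  eq = trans (rearrange (+ m) (σn p - + 1) (a0 p))
             (cong (λ t → t * + m + a0 p) (sym (prime-sum p)))

pattern-dominates-first : (p : Pattern) → StronglyAdmissible p →
  (m : ℕ) → AdmissibleMultiplicity p m →
  (s : Vec ℕ (arity p)) → Descending s → (∀ i → m ℕ.≤ lookup s i) →
  + head s ≤ eval p s
pattern-dominates-first p sa m am s d lo = begin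
  + head s                         ≡⟨ sym (+-identityʳ (+ head s)) ⟩
  + head s + + 0                   ≤⟨ +-monoʳ-≤ (+ head s) (constant-absorbed p sa m am) ⟩
  + head s + (σ' * + m + a0 p)     ≡⟨ sym (+-assoc (+ head s) (σ' * + m) (a0 p)) ⟩
  + head s + σ' * + m + a0 p       ≤⟨ +-monoˡ-≤ (a0 p) (first-variable-bound p (proj₂ sa) m s d lo) ⟩
  evalLin (coeffs p) s + a0 p      ∎
  where
  open ≤-Reasoning
  σ' = sumℤ (primeCoeffs p)

∈ℤ-mono : ∀ {Λ Λ' z} → (∀ x → x ∈ Λ → x ∈ Λ') → z ∈ℤ Λ → z ∈ℤ Λ'
∈ℤ-mono Λ⊆Λ' (k , z≡k , k∈Λ) = k , z≡k , Λ⊆Λ' k k∈Λ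

∈ℤ-upward : ∀ {Λ f z} → (∀ x → f ℕ.≤ x → x ∈ Λ) → + f ≤ z → z ∈ℤ Λ
∈ℤ-upward {z = z} full f≤z =
  ℤ.∣ z ∣ , sym z≡∣z∣ , full ℤ.∣ z ∣ (drop‿+≤+ (subst (+ _ ≤_) (sym z≡∣z∣) f≤z))
  where z≡∣z∣ = 0≤i⇒+∣i∣≡i (≤-trans (+≤+ z≤n) f≤z)

insert-old : ∀ {Λ f x} → x ∈ Λ → x ∈ insert Λ f
insert-old x∈Λ rewrite x∈Λ = refl

insert-new : ∀ {Λ f} → f ∈ insert Λ f
insert-new {Λ} {f} =
  trans (cong (Λ f ∨_) (Equivalence.to T-≡ (ℕₚ.≡⇒≡ᵇ f f refl))) (∨-zeroʳ (Λ f))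

insert-other : ∀ {Λ f x} → x ≢ f → x ∈ insert Λ f → x ∈ Λ
insert-other {Λ} {f} {x} x≢f x∈ with Λ x
... | true = refl
... | false = ⊥-elim (x≢f (ℕₚ.≡ᵇ⇒≡ x f (Equivalence.from T-≡ x∈)))

frobenius-upward : ∀ {Λ f} → IsFrobenius Λ f → ∀ x → f ℕ.≤ x → x ∈ insert Λ f
frobenius-upward {Λ} {f} (_ , above) x f≤x with x ℕ.≟ f
... | yes refl = insert-new {Λ}
... | no x≢f = insert-old {Λ} (above x (ℕₚ.≤∧≢⇒< f≤x (x≢f ∘ sym)))

multiplicity-least : ∀ {Λ m x} → IsMultiplicity Λ m → 1 ℕ.≤ x → x ∈ Λ → m ℕ.≤ x
multiplicity-least {x = x} (_ , _ , below) 1≤x x∈Λ = ℕₚ.≮⇒≥ (λ x<m → below x 1≤x x<m x∈Λ)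

small-frobenius-ordinary : ∀ {Λ m f} → 0 ∈ Λ → IsMultiplicity Λ m → IsFrobenius Λ f →
  f ℕ.< m → Λ ≐ ordinary m
small-frobenius-ordinary 0∈Λ _ _ _ zero = 0∈Λ
small-frobenius-ordinary {Λ} {m} _ mult (_ , above) f<m (suc n) = ⇔→≡ (mk⇔ to from)
  where
  to : suc n ∈ Λ → ordinary m (suc n) ≡ true
  to n∈Λ = Equivalence.to T-≡ (ℕₚ.≤⇒≤ᵇ (multiplicity-least mult (s≤s z≤n) n∈Λ))
  from : ordinary m (suc n) ≡ true → suc n ∈ Λ
  from h = above (suc n) (ℕₚ.<-≤-trans f<m (ℕₚ.≤ᵇ⇒≤ m (suc n) (Equivalence.from T-≡ h)))

frobenius-exceeds-multiplicity : ∀ {Λ m f} → IsNumericalSemigroup Λ → IsMultiplicity Λ m →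
  IsFrobenius Λ f → ¬ (Λ ≐ ordinary m) → m ℕ.≤ f
frobenius-exceeds-multiplicity sg mult frob notOrd =
  ℕₚ.≮⇒≥ (notOrd ∘ small-frobenius-ordinary (IsNumericalSemigroup.has-zero sg) mult frob)

insert-least : ∀ {Λ m f x} → IsMultiplicity Λ m → m ℕ.≤ f →
  1 ℕ.≤ x → x ∈ insert Λ f → m ℕ.≤ x
insert-least {Λ} {f = f} {x} mult m≤f 1≤x x∈ with x ℕ.≟ f
... | yes refl = m≤f
... | no x≢f = multiplicity-least mult 1≤x (insert-other {Λ} x≢f x∈)

frobenius-extension-admits : (p : Pattern) → StronglyAdmissible p →
  (m : ℕ) → AdmissibleMultiplicity p m →
  (Λ : Subset) → IsNumericalSemigroup Λ → IsMultiplicity Λ m →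
  ¬ (Λ ≐ ordinary m) → Admits Λ p →
  (f : ℕ) → IsFrobenius Λ f → Admits (insert Λ f) p
frobenius-extension-admits p sa m am Λ sg mult notOrd adm f frob s@(s₁ ∷ _) mem d
  with f ℕ.≤? s₁
... | no f≰s₁ = ∈ℤ-mono (λ _ → insert-old {Λ} {f}) (adm s old-members d)
  where
  -- all sᵢ ≤ s₁ < f, so none of them is the new element f
  old-members : ∀ i → (1 ℕ.≤ lookup s i) × (lookup s i ∈ Λ)
  old-members i = proj₁ (mem i) , insert-other {Λ} below-f (proj₂ (mem i))
    where
    below-f : lookup s i ≢ f
    below-f refl = f≰s₁ (d fzero i z≤n)
... | yes f≤s₁ = ∈ℤ-upward (frobenius-upward frob)
    (≤-trans (+≤+ f≤s₁) (pattern-dominates-first p sa m am s d at-least-m))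
  where
  m≤f = frobenius-exceeds-multiplicity sg mult frob notOrd
  at-least-m : ∀ i → m ℕ.≤ lookup s i
  at-least-m i = insert-least mult m≤f (proj₁ (mem i)) (proj₂ (mem i))

∩-intro : ∀ {Λ Λ' x} → x ∈ Λ → x ∈ Λ' → x ∈ (Λ ∩ Λ')
∩-intro x∈Λ x∈Λ' rewrite x∈Λ | x∈Λ' = refl

∩-elimˡ : ∀ {Λ Λ' x} → x ∈ (Λ ∩ Λ') → x ∈ Λ
∩-elimˡ {Λ} {x = x} x∈ with Λ x
∩-elimˡ _ | true = refl
∩-elimˡ () | false

∩-elimʳ : ∀ {Λ Λ' x} → x ∈ (Λ ∩ Λ') → x ∈ Λ'
∩-elimʳ {Λ} {x = x} x∈ with Λ x
∩-elimʳ x∈ | true = x∈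
∩-elimʳ () | false

∩-multiplicity : ∀ {Λ Λ' m} → IsMultiplicity Λ m → m ∈ Λ' → IsMultiplicity (Λ ∩ Λ') m
∩-multiplicity {Λ} {Λ'} (1≤m , m∈Λ , below) m∈Λ' =
  1≤m , ∩-intro {Λ} {Λ'} m∈Λ m∈Λ' , λ s 1≤s s<m → below s 1≤s s<m ∘ ∩-elimˡ {Λ} {Λ'}

∩-admits : ∀ {Λ Λ' p} → Admits Λ p → Admits Λ' p → Admits (Λ ∩ Λ') p
∩-admits {Λ} {Λ'} adm adm' s mem d
  with adm s (λ i → proj₁ (mem i) , ∩-elimˡ {Λ} {Λ'} (proj₂ (mem i))) d
     | adm' s (λ i → proj₁ (mem i) , ∩-elimʳ {Λ} {Λ'} (proj₂ (mem i))) d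
... | k , e , k∈Λ | k' , e' , k'∈Λ' =
  k , e , ∩-intro {Λ} {Λ'} k∈Λ (subst (_∈ Λ') (+-injective (trans (sym e') e)) k'∈Λ')

mainTheorem16 : (p : Pattern) → IsPattern p → StronglyAdmissible p →
    (m : ℕ) → AdmissibleMultiplicity p m →
    ((Λ : Subset) → IsNumericalSemigroup Λ → IsMultiplicity Λ m →
      ¬ (Λ ≐ ordinary m) → Admits Λ p →
      (f : ℕ) → IsFrobenius Λ f → Admits (insert Λ f) p)
    × ((Λ Λ' : Subset) → IsNumericalSemigroup Λ → IsNumericalSemigroup Λ' →
      IsMultiplicity Λ m → IsMultiplicity Λ' m → Admits Λ p → Admits Λ' p →
      IsMultiplicity (Λ ∩ Λ') m × Admits (Λ ∩ Λ') p)
mainTheorem16 p _ sa m am =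
  frobenius-extension-admits p sa m am ,
  λ Λ Λ' _ _ mult (_ , m∈Λ' , _) adm adm' →
    ∩-multiplicity mult m∈Λ' , ∩-admits {Λ} {Λ'} adm adm'
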